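{- Let $W$ be a set and let $F:\mathscr P(W)\to\mathscr P(W)$ satisfy, for all $X,Y\subseteq W$: $F(X)\subseteq X$; if $X\neq\emptyset$ then $F(X)\neq\emptyset$; and $F(X\cap Y)\supseteq F(X)\cap Y$. Define $\mathrm{ob}:\mathscr P(W)\to\mathscr P(\mathscr P(W))$ by $\mathrm{ob}(X)=\{Y\subseteq W: Y\supseteq F(X)\}$. Then $\mathrm{ob}$ satisfies: for all $X,Y,Z\subseteq W$, if $Y\subseteq X$, $Y\in\mathrm{ob}(X)$ and $X\subseteq Z$, then $(Z\setminus X)\cup Y\in\mathrm{ob}(Z)$.
   Context: $F(X)$ is interpreted as the set of ideal worlds in context $X$. The conclusion is Carmo and Jones' condition 5(d). -}

module Defs where

open import Data.Bool using (Bool; true; false; _∧_; _∨_; not)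
open import Data.Product using (∃)
open import Level using (Level)

-- 𝒫(W) classically: characteristic functions W → Bool.
𝒫 : ∀ {ℓ} → Set ℓ → Set ℓ
𝒫 W = W → Bool

module _ {ℓ : Level} {W : Set ℓ} where

  _∈_ : W → 𝒫 W → Set
  w ∈ X = X w ≡ true
    where open import Relation.Binary.PropositionalEquality using (_≡_)

  _⊆_ : 𝒫 W → 𝒫 W → Set ℓ
  X ⊆ Y = ∀ w → w ∈ X → w ∈ Y

  ∅ : 𝒫 W
  ∅ _ = false

  _∩_ : 𝒫 W → 𝒫 W → 𝒫 W
  (X ∩ Y) w = X w ∧ Y w

  _∪_ : 𝒫 W → 𝒫 W → 𝒫 W
  (X ∪ Y) w = X w ∨ Y w

  _∖_ : 𝒫 W → 𝒫 W → 𝒫 W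
  (X ∖ Y) w = X w ∧ not (Y w)

  Nonempty : 𝒫 W → Set ℓ
  Nonempty X = ∃ λ w → w ∈ X

  ob : (𝒫 W → 𝒫 W) → 𝒫 W → 𝒫 W → Set ℓ
  ob F X Y = F X ⊆ Y

module Submission where

open import Defs
open import Level using (Level)
open import Relation.Binary.PropositionalEquality
  using (_≡_; _≗_; refl; sym; trans; cong; cong₂)
open import Data.Bool using (false; true; _∧_; _∨_; not)
open import Data.Bool.Properties using (∧-zeroʳ; ∨-zeroʳ)
open import Data.Sum using (_⊎_; inj₁; inj₂)

-- A world ideal in the larger context Z that lies in X is ideal in X, because X = Z ∩ X.
-- So an ideal world of Z either lies outside X, or lies in F(X) ⊆ Y.

module _ {ℓ : Level} {W : Set ℓ} where

  ∈⊎∉ : ∀ (X : 𝒫 W) w → w ∈ X ⊎ X w ≡ false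
  ∈⊎∉ X w with X w
  ... | true = inj₁ refl
  ... | false = inj₂ refl

  ∈-∩ : ∀ (X Y : 𝒫 W) {w} → w ∈ X → w ∈ Y → w ∈ (X ∩ Y)
  ∈-∩ _ _ = cong₂ _∧_

  ∈-∪ʳ : ∀ (X Y : 𝒫 W) {w} → w ∈ Y → w ∈ (X ∪ Y)
  ∈-∪ʳ X _ {w} w∈Y = trans (cong (X w ∨_) w∈Y) (∨-zeroʳ (X w))

  ∈-∖∪ : ∀ (Z X Y : 𝒫 W) {w} → w ∈ Z → X w ≡ false → w ∈ ((Z ∖ X) ∪ Y)
  ∈-∖∪ _ _ Y {w} w∈Z w∉X =
    cong (_∨ Y w) (cong₂ (λ z x → z ∧ not x) w∈Z w∉X)

  ⊆⇒∩≗ : ∀ {X Z : 𝒫 W} → X ⊆ Z → (Z ∩ X) ≗ X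
  ⊆⇒∩≗ {X} {Z} X⊆Z w with X w in w∈X
  ... | false = ∧-zeroʳ (Z w)
  ... | true rewrite X⊆Z w w∈X = refl

  F-∩-⊆ : (F : 𝒫 W → 𝒫 W)
    → (∀ X X′ → (∀ w → X w ≡ X′ w) → ∀ w → F X w ≡ F X′ w)
    → (∀ X Y → (F X ∩ Y) ⊆ F (X ∩ Y))
    → ∀ {X Z} → X ⊆ Z → (F Z ∩ X) ⊆ F X
  F-∩-⊆ F F-ext F-∩ {X} {Z} X⊆Z w w∈FZ∩X =
    trans (sym (F-ext (Z ∩ X) X (⊆⇒∩≗ X⊆Z) w)) (F-∩ Z X w w∈FZ∩X)

theorem2 : {ℓ : Level} (W : Set ℓ) (F : 𝒫 W → 𝒫 W)
    → (∀ X X′ → (∀ w → X w ≡ X′ w) → ∀ w → F X w ≡ F X′ w)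
    → (∀ X → F X ⊆ X)
    → (∀ X → Nonempty X → Nonempty (F X))
    → (∀ X Y → (F X ∩ Y) ⊆ F (X ∩ Y))
    → ∀ X Y Z → Y ⊆ X → ob F X Y → X ⊆ Z → ob F Z ((Z ∖ X) ∪ Y)
theorem2 W F F-ext F-⊆ _ F-∩ X Y Z _ FX⊆Y X⊆Z w w∈FZ with ∈⊎∉ X w
... | inj₁ w∈X = ∈-∪ʳ (Z ∖ X) Y (FX⊆Y w (F-∩-⊆ F F-ext F-∩ X⊆Z w w∈FZ∩X))
  where
  w∈FZ∩X : w ∈ (F Z ∩ X)
  w∈FZ∩X = ∈-∩ (F Z) X w∈FZ w∈X
... | inj₂ w∉X = ∈-∖∪ Z X Y (F-⊆ Z w w∈FZ) w∉X
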